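{- Let $D=xy\frac{\partial}{\partial x}+x^2\frac{\partial}{\partial y}$ be the derivation on Laurent polynomials in $x,y$ with $D(x)=xy$, $D(y)=x^2$, and for a Laurent polynomial $f$ let $\mathrm{Gen}(f,t)=\sum_{n\ge0}D^n(f)\frac{t^n}{n!}$. Then $$\mathrm{Gen}(x^{ -1}y,t)=x^{ -1}y\cosh\big(t\sqrt{y^2-x^2}\big)-x^{ -1}\sqrt{y^2-x^2}\,\sinh\big(t\sqrt{y^2-x^2}\big).$$
   Context: With $s=\sqrt{y^2-x^2}$, $\cosh(ts)=\sum_{n\ge0}s^{2n}\frac{t^{2n}}{(2n)!}$ and $s\sinh(ts)=\sum_{n\ge0}s^{2n+2}\frac{t^{2n+1}}{(2n+1)!}$ as formal power series in $t$ whose coefficients are polynomials in $y^2-x^2$. -}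

module Defs where

open import Data.Integer using (ℤ; +_; -[1+_]; _+_; _*_; -_; _-_; 0ℤ; 1ℤ)
import Data.Integer as ℤ
open import Data.Nat using (ℕ; zero; suc)
open import Data.List using (List; []; _∷_; _++_; map; concatMap)
open import Data.Product using (_×_; _,_)
open import Data.Bool using (if_then_else_; _∧_)
open import Relation.Nullary.Decidable using (⌊_⌋)
open import Relation.Binary.PropositionalEquality using (_≡_)

-- Laurent polynomials in x, y with integer coefficients, represented as
-- finite formal sums of monomials  c · x^i · y^j  (c : ℤ, i j : ℤ).
Term : Set
Term = ℤ × ℤ × ℤ

Laurent : Set
Laurent = List Term

coeff : Laurent → ℤ → ℤ → ℤ
coeff [] a b = 0ℤ
coeff ((c , i , j) ∷ p) a b =
  (if ⌊ i ℤ.≟ a ⌋ ∧ ⌊ j ℤ.≟ b ⌋ then c else 0ℤ) + coeff p a b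

infix 4 _≈L_
_≈L_ : Laurent → Laurent → Set
p ≈L q = ∀ a b → coeff p a b ≡ coeff q a b

infixl 6 _+L_ _-L_
infixl 7 _*L_
_+L_ : Laurent → Laurent → Laurent
p +L q = p ++ q

negL : Laurent → Laurent
negL = map (λ { (c , i , j) → (- c , i , j) })

_-L_ : Laurent → Laurent → Laurent
p -L q = p +L negL q

mulTerm : Term → Term → Term
mulTerm (c , i , j) (d , k , l) = (c * d , i + k , j + l)

_*L_ : Laurent → Laurent → Laurent
p *L q = concatMap (λ s → map (mulTerm s) q) p

0L 1L : Laurent
0L = []
1L = (1ℤ , 0ℤ , 0ℤ) ∷ []

mono : ℤ → ℤ → Laurent
mono i j = (1ℤ , i , j) ∷ []

-- D = x y ∂/∂x + x² ∂/∂y :  D(c x^i y^j) = c i x^i y^(j+1) + c j x^(i+2) y^(j-1)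
DTerm : Term → Laurent
DTerm (c , i , j) = (c * i , i , j + 1ℤ) ∷ (c * j , i + + 2 , j - 1ℤ) ∷ []

D : Laurent → Laurent
D = concatMap DTerm

Dⁿ : ℕ → Laurent → Laurent
Dⁿ zero f = f
Dⁿ (suc n) f = D (Dⁿ n f)

-- Formal power series in t with Laurent-polynomial coefficients, recorded
-- in the basis t^n / n!  (characteristic 0): S n is the coefficient of t^n/n!.
Series : Set
Series = ℕ → Laurent

infix 4 _≈S_
_≈S_ : Series → Series → Set
F ≈S G = ∀ n → F n ≈L G n

_-S_ : Series → Series → Series
(F -S G) n = F n -L G n

_·S_ : Laurent → Series → Series
(f ·S F) n = f *L F n

Gen : Laurent → Series
Gen f n = Dⁿ n f

s² : Laurent
s² = mono 0ℤ (+ 2) -L mono (+ 2) 0ℤ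

-- cosh(ts) = Σ s^{2n} t^{2n}/(2n)!
coshS : Series
coshS zero = 1L
coshS (suc zero) = 0L
coshS (suc (suc n)) = s² *L coshS n

-- s·sinh(ts) = Σ s^{2n+2} t^{2n+1}/(2n+1)!
ssinhS : Series
ssinhS zero = 0L
ssinhS (suc zero) = s²
ssinhS (suc (suc n)) = s² *L ssinhS n

{-# OPTIONS --safe #-}
-- With f = x⁻¹y one computes D²f = (y² − x²) f, and D(y² − x²) = 0, so D commutes with
-- multiplication by s² = y² − x².  Hence Dⁿ⁺²f = s² Dⁿf.  The right-hand side obeys the
-- same two-step recurrence, since its cosh and s·sinh parts are each multiplied by s²
-- when n grows by 2, and it agrees with Gen f at t⁰ and t¹; so the two series coincide.
module Submission where

open import Defs
open import Data.Integer using (ℤ; +_; -[1+_]; _+_; _*_; -_; _-_; 0ℤ; 1ℤ; _≟_)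
import Data.Integer.Properties as ℤ
open import Data.Integer.Tactic.RingSolver using (solve-∀)
open import Data.Nat using (ℕ; zero; suc)
open import Data.List using (_∷_; []; _++_; map)
open import Data.Product using (_,_)
open import Data.Bool using (Bool; true; false; if_then_else_; _∧_)
open import Function.Bundles using (mk⇔)
open import Relation.Nullary.Decidable using (⌊_⌋; does; yes; no; does-⇔; isYes≗does)
open import Relation.Binary.PropositionalEquality
open ≡-Reasoning

two-step-recurrence-unique :
  (T : Laurent → Laurent) → (∀ p q → p ≈L q → T p ≈L T q) →
  {F G : Series} → F 0 ≈L G 0 → F 1 ≈L G 1 →
  (∀ n → F (suc (suc n)) ≈L T (F n)) → (∀ n → G (suc (suc n)) ≈L T (G n)) →
  F ≈S G
two-step-recurrence-unique T T-cong {F} {G} e₀ e₁ stepF stepG = go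
  where
  go : F ≈S G
  go zero = e₀
  go (suc zero) = e₁
  go (suc (suc n)) a b =
    trans (stepF n a b) (trans (T-cong (F n) (G n) (go n) a b) (sym (stepG n a b)))

iverson : Bool → ℤ → ℤ
iverson β c = if β then c else 0ℤ

iverson-*ˡ : ∀ β c d → iverson β (c * d) ≡ c * iverson β d
iverson-*ˡ true c d = refl
iverson-*ˡ false c d = sym (ℤ.*-zeroʳ c)

iverson-*ʳ : ∀ β c d → iverson β (c * d) ≡ iverson β c * d
iverson-*ʳ true c d = refl
iverson-*ʳ false c d = sym (ℤ.*-zeroˡ d)

iverson-neg : ∀ β c → iverson β (- c) ≡ - iverson β c
iverson-neg true c = refl
iverson-neg false c = refl

iverson-substˡ : ∀ {x y} β (f : ℤ → ℤ) → iverson (⌊ x ≟ y ⌋ ∧ β) (f x) ≡ iverson (⌊ x ≟ y ⌋ ∧ β) (f y)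
iverson-substˡ {x} {y} β f with x ≟ y
... | yes refl = refl
... | no _ = refl

iverson-substʳ : ∀ {x y} β (f : ℤ → ℤ) → iverson (β ∧ ⌊ x ≟ y ⌋) (f x) ≡ iverson (β ∧ ⌊ x ≟ y ⌋) (f y)
iverson-substʳ false f = refl
iverson-substʳ {x} {y} true f with x ≟ y
... | yes refl = refl
... | no _ = refl

+≟-shiftˡ : ∀ i k a → ⌊ i + k ≟ a ⌋ ≡ ⌊ k ≟ a - i ⌋
+≟-shiftˡ i k a = begin
  ⌊ i + k ≟ a ⌋       ≡⟨ isYes≗does (i + k ≟ a) ⟩
  does (i + k ≟ a)    ≡⟨ does-⇔ (mk⇔ to from) (i + k ≟ a) (k ≟ a - i) ⟩
  does (k ≟ a - i)    ≡⟨ isYes≗does (k ≟ a - i) ⟨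
  ⌊ k ≟ a - i ⌋       ∎
  where
  k≡i+k-i : ∀ i k → k ≡ i + k - i
  k≡i+k-i = solve-∀
  i+[a-i]≡a : ∀ i a → i + (a - i) ≡ a
  i+[a-i]≡a = solve-∀
  to : i + k ≡ a → k ≡ a - i
  to refl = k≡i+k-i i k
  from : k ≡ a - i → i + k ≡ a
  from refl = i+[a-i]≡a i a

+≟-shiftʳ : ∀ k i a → ⌊ k + i ≟ a ⌋ ≡ ⌊ k ≟ a - i ⌋
+≟-shiftʳ k i a = trans (cong (λ z → ⌊ z ≟ a ⌋) (ℤ.+-comm k i)) (+≟-shiftˡ i k a)

coeff-++ : ∀ p q a b → coeff (p ++ q) a b ≡ coeff p a b + coeff q a b
coeff-++ [] q a b = sym (ℤ.+-identityˡ _)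
coeff-++ ((c , i , j) ∷ p) q a b = begin
  c′ + coeff (p ++ q) a b            ≡⟨ cong (_+_ c′) (coeff-++ p q a b) ⟩
  c′ + (coeff p a b + coeff q a b)   ≡⟨ ℤ.+-assoc c′ _ _ ⟨
  c′ + coeff p a b + coeff q a b     ∎
  where
  c′ : ℤ
  c′ = iverson (⌊ i ≟ a ⌋ ∧ ⌊ j ≟ b ⌋) c

coeff-negL : ∀ p a b → coeff (negL p) a b ≡ - coeff p a b
coeff-negL [] a b = refl
coeff-negL ((c , i , j) ∷ p) a b = begin
  iverson β (- c) + coeff (negL p) a b   ≡⟨ cong₂ _+_ (iverson-neg β c) (coeff-negL p a b) ⟩
  - iverson β c + - coeff p a b          ≡⟨ ℤ.neg-distrib-+ (iverson β c) _ ⟨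
  - (iverson β c + coeff p a b)          ∎
  where
  β : Bool
  β = ⌊ i ≟ a ⌋ ∧ ⌊ j ≟ b ⌋

coeff-−L : ∀ p q a b → coeff (p -L q) a b ≡ coeff p a b - coeff q a b
coeff-−L p q a b = trans (coeff-++ p (negL q) a b) (cong (_+_ (coeff p a b)) (coeff-negL q a b))

coeff-map-mulTerm : ∀ c i j q a b → coeff (map (mulTerm (c , i , j)) q) a b ≡ c * coeff q (a - i) (b - j)
coeff-map-mulTerm c i j [] a b = sym (ℤ.*-zeroʳ c)
coeff-map-mulTerm c i j ((d , k , l) ∷ q) a b = begin
  iverson (⌊ i + k ≟ a ⌋ ∧ ⌊ j + l ≟ b ⌋) (c * d) + coeff (map (mulTerm (c , i , j)) q) a b
    ≡⟨ cong₂ (λ u v → iverson (u ∧ v) (c * d) + _) (+≟-shiftˡ i k a) (+≟-shiftˡ j l b) ⟩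
  iverson β (c * d) + coeff (map (mulTerm (c , i , j)) q) a b
    ≡⟨ cong₂ _+_ (iverson-*ˡ β c d) (coeff-map-mulTerm c i j q a b) ⟩
  c * iverson β d + c * coeff q (a - i) (b - j)
    ≡⟨ ℤ.*-distribˡ-+ c (iverson β d) _ ⟨
  c * (iverson β d + coeff q (a - i) (b - j))   ∎
  where
  β : Bool
  β = ⌊ k ≟ a - i ⌋ ∧ ⌊ l ≟ b - j ⌋

coeff-∷-*L : ∀ c i j p q a b →
  coeff (((c , i , j) ∷ p) *L q) a b ≡ c * coeff q (a - i) (b - j) + coeff (p *L q) a b
coeff-∷-*L c i j p q a b =
  trans (coeff-++ (map (mulTerm (c , i , j)) q) (p *L q) a b)
        (cong (_+ coeff (p *L q) a b) (coeff-map-mulTerm c i j q a b))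

coeff-s²-*L : ∀ q a b → coeff (s² *L q) a b ≡ coeff q a (b - + 2) - coeff q (a - + 2) b
coeff-s²-*L q a b = begin
  coeff (s² *L q) a b
    ≡⟨ coeff-∷-*L 1ℤ 0ℤ (+ 2) (negL (mono (+ 2) 0ℤ)) q a b ⟩
  _ ≡⟨ cong (_+_ (1ℤ * coeff q (a - 0ℤ) (b - + 2))) (coeff-∷-*L -[1+ 0 ] (+ 2) 0ℤ [] q a b) ⟩
  1ℤ * coeff q (a - 0ℤ) (b - + 2) + (-[1+ 0 ] * coeff q (a - + 2) (b - 0ℤ) + 0ℤ)
    ≡⟨ cong₂ (λ u v → 1ℤ * coeff q u (b - + 2) + (-[1+ 0 ] * coeff q (a - + 2) v + 0ℤ))
             (ℤ.+-identityʳ a) (ℤ.+-identityʳ b) ⟩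
  1ℤ * coeff q a (b - + 2) + (-[1+ 0 ] * coeff q (a - + 2) b + 0ℤ)
    ≡⟨ simplify (coeff q a (b - + 2)) (coeff q (a - + 2) b) ⟩
  coeff q a (b - + 2) - coeff q (a - + 2) b   ∎
  where
  simplify : ∀ u v → 1ℤ * u + (-[1+ 0 ] * v + 0ℤ) ≡ u - v
  simplify = solve-∀

coeff-DTerm : ∀ c i j a b → coeff (DTerm (c , i , j)) a b ≡
  iverson (⌊ i ≟ a ⌋ ∧ ⌊ j ≟ b - 1ℤ ⌋) c * a + iverson (⌊ i ≟ a - + 2 ⌋ ∧ ⌊ j ≟ b + 1ℤ ⌋) c * (b + 1ℤ)
coeff-DTerm c i j a b = begin
  iverson (⌊ i ≟ a ⌋ ∧ ⌊ j + 1ℤ ≟ b ⌋) (c * i) + (iverson (⌊ i + + 2 ≟ a ⌋ ∧ ⌊ j - 1ℤ ≟ b ⌋) (c * j) + 0ℤ)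
    ≡⟨ cong₂ (λ u v → iverson (⌊ i ≟ a ⌋ ∧ u) (c * i) + (iverson v (c * j) + 0ℤ))
             (+≟-shiftʳ j 1ℤ b) (cong₂ _∧_ (+≟-shiftʳ i (+ 2) a) (+≟-shiftʳ j -[1+ 0 ] b)) ⟩
  iverson G₁ (c * i) + (iverson G₂ (c * j) + 0ℤ)
    ≡⟨ cong₂ (λ u v → u + (v + 0ℤ)) (iverson-substˡ {i} {a} ⌊ j ≟ b - 1ℤ ⌋ (c *_))
                                    (iverson-substʳ {j} {b + 1ℤ} ⌊ i ≟ a - + 2 ⌋ (c *_)) ⟩
  iverson G₁ (c * a) + (iverson G₂ (c * (b + 1ℤ)) + 0ℤ)
    ≡⟨ cong₂ _+_ (iverson-*ʳ G₁ c a) (ℤ.+-identityʳ _) ⟩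
  iverson G₁ c * a + iverson G₂ (c * (b + 1ℤ))
    ≡⟨ cong (_+_ (iverson G₁ c * a)) (iverson-*ʳ G₂ c (b + 1ℤ)) ⟩
  iverson G₁ c * a + iverson G₂ c * (b + 1ℤ)   ∎
  where
  G₁ G₂ : Bool
  G₁ = ⌊ i ≟ a ⌋ ∧ ⌊ j ≟ b - 1ℤ ⌋
  G₂ = ⌊ i ≟ a - + 2 ⌋ ∧ ⌊ j ≟ b + 1ℤ ⌋

coeff-D : ∀ p a b → coeff (D p) a b ≡ a * coeff p a (b - 1ℤ) + (b + 1ℤ) * coeff p (a - + 2) (b + 1ℤ)
coeff-D [] a b = annihilate a (b + 1ℤ)
  where
  annihilate : ∀ a b → 0ℤ ≡ a * 0ℤ + b * 0ℤ
  annihilate = solve-∀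
coeff-D ((c , i , j) ∷ p) a b = begin
  coeff (DTerm (c , i , j) ++ D p) a b
    ≡⟨ coeff-++ (DTerm (c , i , j)) (D p) a b ⟩
  coeff (DTerm (c , i , j)) a b + coeff (D p) a b
    ≡⟨ cong₂ _+_ (coeff-DTerm c i j a b) (coeff-D p a b) ⟩
  u * a + v * (b + 1ℤ) + (a * coeff p a (b - 1ℤ) + (b + 1ℤ) * coeff p (a - + 2) (b + 1ℤ))
    ≡⟨ regroup a (b + 1ℤ) u v (coeff p a (b - 1ℤ)) (coeff p (a - + 2) (b + 1ℤ)) ⟩
  a * (u + coeff p a (b - 1ℤ)) + (b + 1ℤ) * (v + coeff p (a - + 2) (b + 1ℤ))   ∎
  where
  u v : ℤ
  u = iverson (⌊ i ≟ a ⌋ ∧ ⌊ j ≟ b - 1ℤ ⌋) c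
  v = iverson (⌊ i ≟ a - + 2 ⌋ ∧ ⌊ j ≟ b + 1ℤ ⌋) c
  regroup : ∀ a b u v w z → u * a + v * b + (a * w + b * z) ≡ a * (u + w) + b * (v + z)
  regroup = solve-∀

D-cong : ∀ p q → p ≈L q → D p ≈L D q
D-cong p q e a b = begin
  coeff (D p) a b
    ≡⟨ coeff-D p a b ⟩
  a * coeff p a (b - 1ℤ) + (b + 1ℤ) * coeff p (a - + 2) (b + 1ℤ)
    ≡⟨ cong₂ (λ u v → a * u + (b + 1ℤ) * v) (e a (b - 1ℤ)) (e (a - + 2) (b + 1ℤ)) ⟩
  a * coeff q a (b - 1ℤ) + (b + 1ℤ) * coeff q (a - + 2) (b + 1ℤ)
    ≡⟨ coeff-D q a b ⟨
  coeff (D q) a b   ∎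

s²-*L-cong : ∀ p q → p ≈L q → s² *L p ≈L s² *L q
s²-*L-cong p q e a b = begin
  coeff (s² *L p) a b                          ≡⟨ coeff-s²-*L p a b ⟩
  coeff p a (b - + 2) - coeff p (a - + 2) b    ≡⟨ cong₂ _-_ (e a (b - + 2)) (e (a - + 2) b) ⟩
  coeff q a (b - + 2) - coeff q (a - + 2) b    ≡⟨ coeff-s²-*L q a b ⟨
  coeff (s² *L q) a b                          ∎

D-s²-*L : ∀ p → D (s² *L p) ≈L s² *L D p
D-s²-*L p a b = begin
  coeff (D (s² *L p)) a b
    ≡⟨ coeff-D (s² *L p) a b ⟩
  a * coeff (s² *L p) a (b - 1ℤ) + (b + 1ℤ) * coeff (s² *L p) (a - + 2) (b + 1ℤ)
    ≡⟨ cong₂ (λ u v → a * u + (b + 1ℤ) * v) (coeff-s²-*L p a (b - 1ℤ)) (coeff-s²-*L p (a - + 2) (b + 1ℤ)) ⟩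
  a * (P a (b - 1ℤ - + 2) - P a′ (b - 1ℤ)) + (b + 1ℤ) * (P a′ (b + 1ℤ - + 2) - P (a′ - + 2) (b + 1ℤ))
    ≡⟨ cong₂ (λ u v → a * (P a u - P a′ (b - 1ℤ)) + (b + 1ℤ) * (P a′ v - P (a′ - + 2) (b + 1ℤ)))
             (-1-2≡-2-1 b) (+1-2≡-1 b) ⟩
  a * (P a (b - + 2 - 1ℤ) - P a′ (b - 1ℤ)) + (b + 1ℤ) * (P a′ (b - 1ℤ) - P (a′ - + 2) (b + 1ℤ))
    ≡⟨ regroup a b (P a (b - + 2 - 1ℤ)) (P a′ (b - 1ℤ)) (P (a′ - + 2) (b + 1ℤ)) ⟨
  a * P a (b - + 2 - 1ℤ) + (b - 1ℤ) * P a′ (b - 1ℤ) - Q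
    ≡⟨ cong (λ u → a * P a (b - + 2 - 1ℤ) + u * P a′ u - Q) (-2+1≡-1 b) ⟨
  a * P a (b - + 2 - 1ℤ) + (b - + 2 + 1ℤ) * P a′ (b - + 2 + 1ℤ) - Q
    ≡⟨ cong₂ _-_ (coeff-D p a (b - + 2)) (coeff-D p a′ b) ⟨
  coeff (D p) a (b - + 2) - coeff (D p) a′ b
    ≡⟨ coeff-s²-*L (D p) a b ⟨
  coeff (s² *L D p) a b   ∎
  where
  P : ℤ → ℤ → ℤ
  P = coeff p
  a′ Q : ℤ
  a′ = a - + 2
  Q = a′ * P a′ (b - 1ℤ) + (b + 1ℤ) * P (a′ - + 2) (b + 1ℤ)
  -1-2≡-2-1 : ∀ b → b - 1ℤ - + 2 ≡ b - + 2 - 1ℤ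
  -1-2≡-2-1 = solve-∀
  +1-2≡-1 : ∀ b → b + 1ℤ - + 2 ≡ b - 1ℤ
  +1-2≡-1 = solve-∀
  -2+1≡-1 : ∀ b → b - + 2 + 1ℤ ≡ b - 1ℤ
  -2+1≡-1 = solve-∀
  regroup : ∀ a b u v w → a * u + (b - 1ℤ) * v - ((a - + 2) * v + (b + 1ℤ) * w) ≡ a * (u - v) + (b + 1ℤ) * (v - w)
  regroup = solve-∀

*L-s²-*L : ∀ p q → p *L (s² *L q) ≈L s² *L (p *L q)
*L-s²-*L [] q a b = refl
*L-s²-*L ((c , i , j) ∷ p) q a b = begin
  coeff (((c , i , j) ∷ p) *L (s² *L q)) a b
    ≡⟨ coeff-∷-*L c i j p (s² *L q) a b ⟩
  c * coeff (s² *L q) (a - i) (b - j) + coeff (p *L (s² *L q)) a b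
    ≡⟨ cong₂ (λ u v → c * u + v) (coeff-s²-*L q (a - i) (b - j))
             (trans (*L-s²-*L p q a b) (coeff-s²-*L (p *L q) a b)) ⟩
  c * (Q (a - i) (b - j - + 2) - Q (a - i - + 2) (b - j)) + (R a (b - + 2) - R (a - + 2) b)
    ≡⟨ cong₂ (λ u v → c * (Q (a - i) u - Q v (b - j)) + (R a (b - + 2) - R (a - + 2) b))
             (-j-2≡-2-j b j) (-j-2≡-2-j a i) ⟩
  c * (Q (a - i) (b - + 2 - j) - Q (a - + 2 - i) (b - j)) + (R a (b - + 2) - R (a - + 2) b)
    ≡⟨ regroup c (Q (a - i) (b - + 2 - j)) (Q (a - + 2 - i) (b - j)) (R a (b - + 2)) (R (a - + 2) b) ⟩
  (c * Q (a - i) (b - + 2 - j) + R a (b - + 2)) - (c * Q (a - + 2 - i) (b - j) + R (a - + 2) b)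
    ≡⟨ cong₂ _-_ (coeff-∷-*L c i j p q a (b - + 2)) (coeff-∷-*L c i j p q (a - + 2) b) ⟨
  coeff (((c , i , j) ∷ p) *L q) a (b - + 2) - coeff (((c , i , j) ∷ p) *L q) (a - + 2) b
    ≡⟨ coeff-s²-*L (((c , i , j) ∷ p) *L q) a b ⟨
  coeff (s² *L (((c , i , j) ∷ p) *L q)) a b   ∎
  where
  Q R : ℤ → ℤ → ℤ
  Q = coeff q
  R = coeff (p *L q)
  -j-2≡-2-j : ∀ b j → b - j - + 2 ≡ b - + 2 - j
  -j-2≡-2-j = solve-∀
  regroup : ∀ c u v w z → c * (u - v) + (w - z) ≡ (c * u + w) - (c * v + z)
  regroup = solve-∀

D²≈s²-closed-under-D : ∀ g → D (D g) ≈L s² *L g → D (D (D g)) ≈L s² *L D g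
D²≈s²-closed-under-D g e a b = trans (D-cong (D (D g)) (s² *L g) e a b) (D-s²-*L g a b)

Gen-two-step : ∀ f → D (D f) ≈L s² *L f → ∀ n → Gen f (suc (suc n)) ≈L s² *L Gen f n
Gen-two-step f e zero = e
Gen-two-step f e (suc n) = D²≈s²-closed-under-D (Gen f n) (Gen-two-step f e n)

cosh-ssinh-two-step : ∀ f g n →
  ((f ·S coshS) -S (g ·S ssinhS)) (suc (suc n)) ≈L s² *L ((f ·S coshS) -S (g ·S ssinhS)) n
cosh-ssinh-two-step f g n a b = begin
  coeff (f *L (s² *L coshS n) -L g *L (s² *L ssinhS n)) a b
    ≡⟨ coeff-−L (f *L (s² *L coshS n)) (g *L (s² *L ssinhS n)) a b ⟩
  coeff (f *L (s² *L coshS n)) a b - coeff (g *L (s² *L ssinhS n)) a b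
    ≡⟨ cong₂ _-_ (trans (*L-s²-*L f (coshS n) a b) (coeff-s²-*L (f *L coshS n) a b))
                 (trans (*L-s²-*L g (ssinhS n) a b) (coeff-s²-*L (g *L ssinhS n) a b)) ⟩
  (C a (b - + 2) - C (a - + 2) b) - (S a (b - + 2) - S (a - + 2) b)
    ≡⟨ interchange (C a (b - + 2)) (C (a - + 2) b) (S a (b - + 2)) (S (a - + 2) b) ⟩
  (C a (b - + 2) - S a (b - + 2)) - (C (a - + 2) b - S (a - + 2) b)
    ≡⟨ cong₂ _-_ (coeff-−L (f *L coshS n) (g *L ssinhS n) a (b - + 2))
                 (coeff-−L (f *L coshS n) (g *L ssinhS n) (a - + 2) b) ⟨
  coeff (f *L coshS n -L g *L ssinhS n) a (b - + 2) - coeff (f *L coshS n -L g *L ssinhS n) (a - + 2) b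
    ≡⟨ coeff-s²-*L (f *L coshS n -L g *L ssinhS n) a b ⟨
  coeff (s² *L (f *L coshS n -L g *L ssinhS n)) a b   ∎
  where
  C S : ℤ → ℤ → ℤ
  C = coeff (f *L coshS n)
  S = coeff (g *L ssinhS n)
  interchange : ∀ u v w z → (u - v) - (w - z) ≡ (u - w) - (v - z)
  interchange = solve-∀

D²-x⁻¹y : D (D (mono -[1+ 0 ] (+ 1))) ≈L s² *L mono -[1+ 0 ] (+ 1)
D²-x⁻¹y a b = combine (at -[1+ 0 ] (+ 3)) (at (+ 1) (+ 1)) (at (+ 3) -[1+ 0 ])
  where
  at : ℤ → ℤ → Bool
  at i j = ⌊ i ≟ a ⌋ ∧ ⌊ j ≟ b ⌋
  -- D²(x⁻¹y) = x⁻¹y³ − 2xy + xy + 0·x³y⁻¹: the two xy terms merge into the −xy of s²·x⁻¹y.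
  combine : ∀ β γ δ → iverson β 1ℤ + (iverson γ -[1+ 1 ] + (iverson γ 1ℤ + (iverson δ 0ℤ + 0ℤ)))
                      ≡ iverson β 1ℤ + (iverson γ -[1+ 0 ] + 0ℤ)
  combine β true  true  = refl
  combine β true  false = refl
  combine β false true  = refl
  combine β false false = refl

theorem2p6 : Gen (mono (-[1+ 0 ]) (+ 1))
               ≈S ((mono (-[1+ 0 ]) (+ 1) ·S coshS) -S (mono (-[1+ 0 ]) (+ 0) ·S ssinhS))
theorem2p6 =
  two-step-recurrence-unique (s² *L_) s²-*L-cong {Gen x⁻¹y} {(x⁻¹y ·S coshS) -S (x⁻¹ ·S ssinhS)}
    (λ _ _ → refl) (λ _ _ → refl)
    (Gen-two-step x⁻¹y D²-x⁻¹y)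
    (cosh-ssinh-two-step x⁻¹y x⁻¹)
  where
  x⁻¹y x⁻¹ : Laurent
  x⁻¹y = mono -[1+ 0 ] (+ 1)
  x⁻¹ = mono -[1+ 0 ] (+ 0)
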